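{- Let $i\ge 0$ be an integer, let $n$ be an integer with $0<n<2^i$, and let $k=\lceil \log_2(n)\rceil$. Then $$f(n,i) = f(n,k) + (i-k)\cdot f(2^k-n,k).$$
   Context: For an integer $n$ and an integer $i\ge 0$, $f(n,i)$ denotes the number of binary signed-digit (BSD) representations of $n$ on $i$ bits, i.e. the number of tuples $(b_{i-1},\dots,b_0)\in\{1,0,-1\}^i$ with $n=\sum_{j=0}^{i-1} b_j 2^j$ (for $i=0$ the only tuple is the empty one, representing $0$). -}

module Defs where

open import Data.Nat using (ℕ; zero; suc)
open import Data.Integer using (ℤ; +_; -[1+_]; _+_; _*_)
open import Data.List using (List; []; _∷_; concatMap; map; filter; length)
open import Data.Vec using (Vec; []; _∷_)
open import Relation.Binary.PropositionalEquality using (_≡_)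
import Data.Integer.Properties as ℤP

data BSD : Set where
  one zer neg : BSD

digitValue : BSD → ℤ
digitValue one = + 1
digitValue zer = + 0
digitValue neg = -[1+ 0 ]

-- All tuples in {1,0,-1}^i, as vectors (b_0, b_1, ..., b_{i-1}) (least significant first).
allTuples : (i : ℕ) → List (Vec BSD i)
allTuples zero = [] ∷ []
allTuples (suc i) = concatMap (λ v → map (λ b → b ∷ v) (one ∷ zer ∷ neg ∷ [])) (allTuples i)

value : {i : ℕ} → Vec BSD i → ℤ
value [] = + 0
value (b ∷ v) = digitValue b + (+ 2) * value v

f : ℤ → ℕ → ℕ
f n i = length (filter (λ v → value v ℤP.≟ n) (allTuples i))

{-# OPTIONS --safe #-}
-- Splitting off the most significant digit gives
--   f(m, j+1) = f(m - 2^j, j) + f(m, j) + f(m + 2^j, j),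
-- where f(-m, j) = f(m, j) and no value >= 2^j is representable on j bits.
-- Hence for 0 <= x <= 2^j both f(x, j+1) = f(x, j) + f(2^j - x, j) and
-- f(2^(j+1) - x, j+1) = f(2^j - x, j): once j >= k the correction term
-- f(2^j - x, j) stays equal to f(2^k - x, k), so f(x, j) grows linearly in j.
module Submission where

open import Defs
open import Data.Bool using (Bool; true; false)
import Data.Integer as ℤ
open import Data.Integer using (ℤ; +_; -[1+_]; 0ℤ; _<_; _-_; -_; +<+; +≤+; -≤+)
import Data.Integer.Properties as ℤP
open import Data.Integer.Tactic.RingSolver using (solve-∀)
open import Data.List using (List; []; _∷_; concatMap; map; filter; length)
import Data.Nat as ℕ
open import Data.Nat using (ℕ; zero; suc; _∸_; _^_; z≤n; s≤s; ⌊_/2⌋; ⌈_/2⌉)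
open import Data.Nat.Induction using (Acc; acc; <-wellFounded)
open import Data.Nat.Logarithm using (⌈log₂_⌉; ⌈log₂⌉-mono-≤; ⌈log₂2^n⌉≡n)
open import Data.Nat.Logarithm.Core using (⌈log2⌉)
import Data.Nat.Properties as ℕP
open import Data.Vec as Vec using (Vec; []; _∷_; _∷ʳ_)
open import Function using (_∘_; _⇔_; mk⇔)
open import Relation.Binary.PropositionalEquality
open import Relation.Nullary using (does)
open import Relation.Nullary.Decidable using (dec-false; does-⇔)
open import Relation.Unary using (Pred; Decidable)

open import Algebra.Properties.CommutativeSemigroup ℕP.+-commutativeSemigroup using (interchange; xy∙z≈zy∙x)

sumBSD : (BSD → ℕ) → ℕ
sumBSD g = g one ℕ.+ g zer ℕ.+ g neg

sumBSD-cong : ∀ {g h : BSD → ℕ} → (∀ b → g b ≡ h b) → sumBSD g ≡ sumBSD h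
sumBSD-cong g≗h = cong₂ ℕ._+_ (cong₂ ℕ._+_ (g≗h one) (g≗h zer)) (g≗h neg)

sumBSD-distrib-+ : ∀ (g h : BSD → ℕ) → sumBSD (λ b → g b ℕ.+ h b) ≡ sumBSD g ℕ.+ sumBSD h
sumBSD-distrib-+ g h = trans (cong (ℕ._+ (g neg ℕ.+ h neg)) (interchange (g one) (h one) (g zer) (h zer)))
                             (interchange (g one ℕ.+ g zer) (h one ℕ.+ h zer) (g neg) (h neg))

sumBSD-comm : ∀ (g : BSD → BSD → ℕ) →
  sumBSD (λ a → sumBSD (λ b → g a b)) ≡ sumBSD (λ b → sumBSD (λ a → g a b))
sumBSD-comm g = trans (sumBSD-distrib-+ (λ a → g a one ℕ.+ g a zer) (λ a → g a neg))
                      (cong (ℕ._+ sumBSD (λ a → g a neg)) (sumBSD-distrib-+ (λ a → g a one) (λ a → g a zer)))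

negateDigit : BSD → BSD
negateDigit one = neg
negateDigit zer = zer
negateDigit neg = one

sumBSD-negate : ∀ (g : BSD → ℕ) → sumBSD g ≡ sumBSD (g ∘ negateDigit)
sumBSD-negate g = xy∙z≈zy∙x (g one) (g zer) (g neg)

indicator : Bool → ℕ
indicator false = 0
indicator true  = 1

count : (i : ℕ) → (Vec BSD i → Bool) → ℕ
count zero    p = indicator (p [])
count (suc i) p = sumBSD (λ b → count i (p ∘ (b ∷_)))

count-cong : ∀ i {p q : Vec BSD i → Bool} → (∀ v → p v ≡ q v) → count i p ≡ count i q
count-cong zero    p≗q = cong indicator (p≗q [])
count-cong (suc i) p≗q = sumBSD-cong λ b → count-cong i (p≗q ∘ (b ∷_))

count-false : ∀ i {p : Vec BSD i → Bool} → (∀ v → p v ≡ false) → count i p ≡ 0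
count-false zero    p≡false = cong indicator (p≡false [])
count-false (suc i) p≡false = sumBSD-cong λ b → count-false i (p≡false ∘ (b ∷_))

count-negate : ∀ i (p : Vec BSD i → Bool) → count i p ≡ count i (p ∘ Vec.map negateDigit)
count-negate zero    p = refl
count-negate (suc i) p = begin
  sumBSD (λ b → count i (p ∘ (b ∷_)))
    ≡⟨ sumBSD-cong (λ b → count-negate i (p ∘ (b ∷_))) ⟩
  sumBSD (λ b → count i (λ v → p (b ∷ Vec.map negateDigit v)))
    ≡⟨ sumBSD-negate (λ b → count i (λ v → p (b ∷ Vec.map negateDigit v))) ⟩
  count (suc i) (p ∘ Vec.map negateDigit) ∎
  where open ≡-Reasoning

count-∷ʳ : ∀ i (p : Vec BSD (suc i) → Bool) → count (suc i) p ≡ sumBSD (λ b → count i (p ∘ (_∷ʳ b)))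
count-∷ʳ zero    p = refl
count-∷ʳ (suc i) p = begin
  sumBSD (λ a → count (suc i) (p ∘ (a ∷_)))
    ≡⟨ sumBSD-cong (λ a → count-∷ʳ i (p ∘ (a ∷_))) ⟩
  sumBSD (λ a → sumBSD (λ b → count i (λ v → p (a ∷ (v ∷ʳ b)))))
    ≡⟨ sumBSD-comm (λ a b → count i (λ v → p (a ∷ (v ∷ʳ b)))) ⟩
  sumBSD (λ b → count (suc i) (p ∘ (_∷ʳ b))) ∎
  where open ≡-Reasoning

length-filter-∷ : ∀ {a p} {A : Set a} {P : Pred A p} (P? : Decidable P) x xs →
  length (filter P? (x ∷ xs)) ≡ indicator (does (P? x)) ℕ.+ length (filter P? xs)
length-filter-∷ P? x xs with does (P? x)
... | false = refl
... | true  = refl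

length-filter-concatMap-∷ : ∀ {i p} {P : Pred (Vec BSD (suc i)) p} (P? : Decidable P) (xs : List (Vec BSD i)) →
  length (filter P? (concatMap (λ v → map (_∷ v) (one ∷ zer ∷ neg ∷ [])) xs))
    ≡ sumBSD (λ b → length (filter (P? ∘ (b ∷_)) xs))
length-filter-concatMap-∷ P? [] = refl
length-filter-concatMap-∷ P? (x ∷ xs) = begin
  length (filter P? ((one ∷ x) ∷ (zer ∷ x) ∷ (neg ∷ x) ∷ rest))
    ≡⟨ trans (length-filter-∷ P? _ _) (cong (_ ℕ.+_)
        (trans (length-filter-∷ P? _ _) (cong (_ ℕ.+_) (length-filter-∷ P? _ _)))) ⟩
  ind one ℕ.+ (ind zer ℕ.+ (ind neg ℕ.+ length (filter P? rest)))
    ≡⟨ sym (trans (ℕP.+-assoc (ind one ℕ.+ ind zer) (ind neg) _) (ℕP.+-assoc (ind one) (ind zer) _)) ⟩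
  sumBSD ind ℕ.+ length (filter P? rest)
    ≡⟨ cong (sumBSD ind ℕ.+_) (length-filter-concatMap-∷ P? xs) ⟩
  sumBSD ind ℕ.+ sumBSD (λ b → length (filter (P? ∘ (b ∷_)) xs))
    ≡⟨ sym (sumBSD-distrib-+ ind (λ b → length (filter (P? ∘ (b ∷_)) xs))) ⟩
  sumBSD (λ b → ind b ℕ.+ length (filter (P? ∘ (b ∷_)) xs))
    ≡⟨ sumBSD-cong (λ b → sym (length-filter-∷ (P? ∘ (b ∷_)) x xs)) ⟩
  sumBSD (λ b → length (filter (P? ∘ (b ∷_)) (x ∷ xs))) ∎
  where
  open ≡-Reasoning
  rest = concatMap (λ v → map (_∷ v) (one ∷ zer ∷ neg ∷ [])) xs
  ind : BSD → ℕ
  ind b = indicator (does (P? (b ∷ x)))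

length-filter-allTuples : ∀ i {p} {P : Pred (Vec BSD i) p} (P? : Decidable P) →
  length (filter P? (allTuples i)) ≡ count i (does ∘ P?)
length-filter-allTuples zero    P? = trans (length-filter-∷ P? [] []) (ℕP.+-identityʳ _)
length-filter-allTuples (suc i) P? = begin
  length (filter P? (allTuples (suc i)))
    ≡⟨ length-filter-concatMap-∷ P? (allTuples i) ⟩
  sumBSD (λ b → length (filter (P? ∘ (b ∷_)) (allTuples i)))
    ≡⟨ sumBSD-cong (λ b → length-filter-allTuples i (P? ∘ (b ∷_))) ⟩
  count (suc i) (does ∘ P?) ∎
  where open ≡-Reasoning

digitValue-negate : ∀ b → digitValue (negateDigit b) ≡ - digitValue b
digitValue-negate one = refl
digitValue-negate zer = refl
digitValue-negate neg = refl

digitValue≤1 : ∀ b → digitValue b ℤ.≤ + 1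
digitValue≤1 one = +≤+ (s≤s z≤n)
digitValue≤1 zer = +≤+ z≤n
digitValue≤1 neg = -≤+

value-negate : ∀ {i} (v : Vec BSD i) → value (Vec.map negateDigit v) ≡ - value v
value-negate []      = refl
value-negate (b ∷ v) = begin
  digitValue (negateDigit b) ℤ.+ + 2 ℤ.* value (Vec.map negateDigit v)
    ≡⟨ cong₂ (λ x y → x ℤ.+ + 2 ℤ.* y) (digitValue-negate b) (value-negate v) ⟩
  - digitValue b ℤ.+ + 2 ℤ.* - value v
    ≡⟨ negate-linear (digitValue b) (value v) ⟩
  - value (b ∷ v) ∎
  where
  open ≡-Reasoning
  negate-linear : ∀ x y → - x ℤ.+ + 2 ℤ.* - y ≡ - (x ℤ.+ + 2 ℤ.* y)
  negate-linear = solve-∀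

value-∷ʳ : ∀ {i} (v : Vec BSD i) b → value (v ∷ʳ b) ≡ value v ℤ.+ digitValue b ℤ.* + (2 ^ i)
value-∷ʳ []  one = refl
value-∷ʳ []  zer = refl
value-∷ʳ []  neg = refl
value-∷ʳ {suc i} (c ∷ v) b = begin
  digitValue c ℤ.+ + 2 ℤ.* value (v ∷ʳ b)
    ≡⟨ cong (λ t → digitValue c ℤ.+ + 2 ℤ.* t) (value-∷ʳ v b) ⟩
  digitValue c ℤ.+ + 2 ℤ.* (value v ℤ.+ digitValue b ℤ.* + (2 ^ i))
    ≡⟨ regroup (digitValue c) (value v) (digitValue b) (+ (2 ^ i)) ⟩
  value (c ∷ v) ℤ.+ digitValue b ℤ.* (+ 2 ℤ.* + (2 ^ i))
    ≡⟨ cong (λ t → value (c ∷ v) ℤ.+ digitValue b ℤ.* t) (sym (ℤP.pos-* 2 (2 ^ i))) ⟩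
  value (c ∷ v) ℤ.+ digitValue b ℤ.* + (2 ^ suc i) ∎
  where
  open ≡-Reasoning
  regroup : ∀ x y z w → x ℤ.+ + 2 ℤ.* (y ℤ.+ z ℤ.* w) ≡ (x ℤ.+ + 2 ℤ.* y) ℤ.+ z ℤ.* (+ 2 ℤ.* w)
  regroup = solve-∀

value<2^ : ∀ {i} (v : Vec BSD i) → value v < + (2 ^ i)
value<2^ []      = +<+ (s≤s z≤n)
value<2^ {suc i} (b ∷ v) = begin-strict
  digitValue b ℤ.+ + 2 ℤ.* value v  ≤⟨ ℤP.+-monoˡ-≤ (+ 2 ℤ.* value v) (digitValue≤1 b) ⟩
  + 1 ℤ.+ + 2 ℤ.* value v           <⟨ ℤP.+-monoˡ-< (+ 2 ℤ.* value v) (+<+ (s≤s (s≤s z≤n))) ⟩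
  + 2 ℤ.+ + 2 ℤ.* value v           ≡⟨ ℤP.*-distribˡ-+ (+ 2) (+ 1) (value v) ⟨
  + 2 ℤ.* (+ 1 ℤ.+ value v)         ≤⟨ ℤP.*-monoˡ-≤-nonNeg (+ 2) (ℤP.i<j⇒suc[i]≤j (value<2^ v)) ⟩
  + 2 ℤ.* + (2 ^ i)                 ≡⟨ ℤP.pos-* 2 (2 ^ i) ⟨
  + (2 ^ suc i)                     ∎
  where open ℤP.≤-Reasoning

hasValue : ∀ {i} → ℤ → Vec BSD i → Bool
hasValue m v = does (value v ℤP.≟ m)

f≡count : ∀ m i → f m i ≡ count i (hasValue m)
f≡count m i = length-filter-allTuples i (λ v → value v ℤP.≟ m)

+≡⇔≡- : ∀ x y m → (x ℤ.+ y ≡ m) ⇔ (x ≡ m - y)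
+≡⇔≡- x y m = mk⇔ (λ x+y≡m → trans (sym (x+y-y≡x x y)) (cong (_- y) x+y≡m))
                   (λ x≡m-y → trans (cong (ℤ._+ y) x≡m-y) (x-y+y≡x m y))
  where
  x+y-y≡x : ∀ x y → x ℤ.+ y - y ≡ x
  x+y-y≡x = solve-∀
  x-y+y≡x : ∀ x y → x - y ℤ.+ y ≡ x
  x-y+y≡x = solve-∀

count-hasValue-∷ʳ : ∀ i m b →
  count i (hasValue m ∘ (_∷ʳ b)) ≡ f (m - digitValue b ℤ.* + (2 ^ i)) i
count-hasValue-∷ʳ i m b = begin
  count i (hasValue m ∘ (_∷ʳ b))
    ≡⟨ count-cong i (λ v → trans (cong (λ t → does (t ℤP.≟ m)) (value-∷ʳ v b))
                                 (does-⇔ (+≡⇔≡- (value v) (digitValue b ℤ.* + (2 ^ i)) m) (_ ℤP.≟ m) (value v ℤP.≟ _))) ⟩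
  count i (hasValue (m - digitValue b ℤ.* + (2 ^ i)))
    ≡⟨ f≡count _ i ⟨
  f (m - digitValue b ℤ.* + (2 ^ i)) i ∎
  where open ≡-Reasoning

f-suc : ∀ i m → f m (suc i) ≡ f (m - + (2 ^ i)) i ℕ.+ f m i ℕ.+ f (m ℤ.+ + (2 ^ i)) i
f-suc i m = begin
  f m (suc i)                                    ≡⟨ f≡count m (suc i) ⟩
  count (suc i) (hasValue m)                     ≡⟨ count-∷ʳ i (hasValue m) ⟩
  sumBSD (λ b → count i (hasValue m ∘ (_∷ʳ b)))  ≡⟨ sumBSD-cong (count-hasValue-∷ʳ i m) ⟩
  sumBSD (λ b → f (m - digitValue b ℤ.* P) i)
    ≡⟨ cong₂ ℕ._+_ (cong₂ ℕ._+_ (cong (λ t → f t i) (top-one m P)) (cong (λ t → f t i) (top-zer m P)))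
                   (cong (λ t → f t i) (top-neg m P)) ⟩
  f (m - P) i ℕ.+ f m i ℕ.+ f (m ℤ.+ P) i       ∎
  where
  open ≡-Reasoning
  P = + (2 ^ i)
  top-one : ∀ m P → m - + 1 ℤ.* P ≡ m - P
  top-one = solve-∀
  top-zer : ∀ m P → m - + 0 ℤ.* P ≡ m
  top-zer = solve-∀
  top-neg : ∀ m P → m - -[1+ 0 ] ℤ.* P ≡ m ℤ.+ P
  top-neg = solve-∀

f-neg : ∀ m i → f (- m) i ≡ f m i
f-neg m i = begin
  f (- m) i                                          ≡⟨ f≡count (- m) i ⟩
  count i (hasValue (- m))                           ≡⟨ count-negate i (hasValue (- m)) ⟩
  count i (hasValue (- m) ∘ Vec.map negateDigit)     ≡⟨ count-cong i negated ⟩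
  count i (hasValue m)                               ≡⟨ f≡count m i ⟨
  f m i ∎
  where
  open ≡-Reasoning
  negated : ∀ v → hasValue (- m) (Vec.map negateDigit v) ≡ hasValue m v
  negated v = does-⇔ (mk⇔ (λ e → ℤP.neg-injective (trans (sym (value-negate v)) e))
                          (λ e → trans (value-negate v) (cong -_ e)))
                     (value (Vec.map negateDigit v) ℤP.≟ - m) (value v ℤP.≟ m)

f-out-of-range : ∀ i {m} → 0ℤ ℤ.≤ m → f (m ℤ.+ + (2 ^ i)) i ≡ 0
f-out-of-range i {m} 0≤m = trans (f≡count _ i) (count-false i λ v →
  dec-false (value v ℤP.≟ m ℤ.+ + (2 ^ i)) λ e →
    ℤP.<⇒≱ (value<2^ v) (subst (+ (2 ^ i) ℤ.≤_) (sym e) (ℤP.+-monoˡ-≤ (+ (2 ^ i)) 0≤m)))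

f-suc-low : ∀ i {m} → 0ℤ ℤ.≤ m → f m (suc i) ≡ f m i ℕ.+ f (+ (2 ^ i) - m) i
f-suc-low i {m} 0≤m = begin
  f m (suc i)                                   ≡⟨ f-suc i m ⟩
  f (m - P) i ℕ.+ f m i ℕ.+ f (m ℤ.+ P) i       ≡⟨ cong (f (m - P) i ℕ.+ f m i ℕ.+_) (f-out-of-range i 0≤m) ⟩
  f (m - P) i ℕ.+ f m i ℕ.+ 0                   ≡⟨ ℕP.+-identityʳ _ ⟩
  f (m - P) i ℕ.+ f m i                         ≡⟨ ℕP.+-comm (f (m - P) i) (f m i) ⟩
  f m i ℕ.+ f (m - P) i                         ≡⟨ cong (f m i ℕ.+_) (trans (cong (λ t → f t i) (swap m P)) (f-neg _ i)) ⟩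
  f m i ℕ.+ f (P - m) i                         ∎
  where
  open ≡-Reasoning
  P = + (2 ^ i)
  swap : ∀ m P → m - P ≡ - (P - m)
  swap = solve-∀

f-suc-high : ∀ i {m} → 0ℤ ℤ.≤ m → f (m ℤ.+ + (2 ^ i)) (suc i) ≡ f m i
f-suc-high i {m} 0≤m = begin
  f (m ℤ.+ P) (suc i)                                     ≡⟨ f-suc i (m ℤ.+ P) ⟩
  f (m ℤ.+ P - P) i ℕ.+ f (m ℤ.+ P) i ℕ.+ f (m ℤ.+ P ℤ.+ P) i
    ≡⟨ cong₂ (λ x y → f (m ℤ.+ P - P) i ℕ.+ x ℕ.+ y) (f-out-of-range i 0≤m) (f-out-of-range i 0≤m+P) ⟩
  f (m ℤ.+ P - P) i ℕ.+ 0 ℕ.+ 0                           ≡⟨ trans (ℕP.+-identityʳ _) (ℕP.+-identityʳ _) ⟩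
  f (m ℤ.+ P - P) i                                       ≡⟨ cong (λ t → f t i) (cancel m P) ⟩
  f m i                                                   ∎
  where
  open ≡-Reasoning
  P = + (2 ^ i)
  0≤m+P : 0ℤ ℤ.≤ m ℤ.+ P
  0≤m+P = ℤP.+-mono-≤ 0≤m (+≤+ z≤n)
  cancel : ∀ m P → m ℤ.+ P - P ≡ m
  cancel = solve-∀

n≤2^[d+k] : ∀ {k n} → n ℤ.≤ + (2 ^ k) → ∀ d → n ℤ.≤ + (2 ^ (d ℕ.+ k))
n≤2^[d+k] {k} n≤2^k d = ℤP.≤-trans n≤2^k (+≤+ (ℕP.^-monoʳ-≤ 2 (ℕP.m≤n+m k d)))

f-complement-stable : ∀ {k} {n} → n ℤ.≤ + (2 ^ k) →
  ∀ d → f (+ (2 ^ (d ℕ.+ k)) - n) (d ℕ.+ k) ≡ f (+ (2 ^ k) - n) k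
f-complement-stable         n≤2^k zero    = refl
f-complement-stable {k} {n} n≤2^k (suc d) = begin
  f (+ (2 ^ suc j) - n) (suc j)
    ≡⟨ cong (λ t → f t (suc j)) (trans (cong (_- n) (ℤP.pos-* 2 (2 ^ j))) (double (+ (2 ^ j)) n)) ⟩
  f (+ (2 ^ j) - n ℤ.+ + (2 ^ j)) (suc j)
    ≡⟨ f-suc-high j (ℤP.i≤j⇒0≤j-i (n≤2^[d+k] n≤2^k d)) ⟩
  f (+ (2 ^ j) - n) j
    ≡⟨ f-complement-stable n≤2^k d ⟩
  f (+ (2 ^ k) - n) k ∎
  where
  open ≡-Reasoning
  j = d ℕ.+ k
  double : ∀ P n → + 2 ℤ.* P - n ≡ P - n ℤ.+ P
  double = solve-∀

f-extra-bits : ∀ {k} {n} → 0ℤ ℤ.≤ n → n ℤ.≤ + (2 ^ k) →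
  ∀ d → f n (d ℕ.+ k) ≡ f n k ℕ.+ d ℕ.* f (+ (2 ^ k) - n) k
f-extra-bits         0≤n n≤2^k zero    = sym (ℕP.+-identityʳ _)
f-extra-bits {k} {n} 0≤n n≤2^k (suc d) = begin
  f n (suc (d ℕ.+ k))                                     ≡⟨ f-suc-low (d ℕ.+ k) 0≤n ⟩
  f n (d ℕ.+ k) ℕ.+ f (+ (2 ^ (d ℕ.+ k)) - n) (d ℕ.+ k)
    ≡⟨ cong₂ ℕ._+_ (f-extra-bits 0≤n n≤2^k d) (f-complement-stable n≤2^k d) ⟩
  f n k ℕ.+ d ℕ.* c ℕ.+ c                                 ≡⟨ ℕP.+-assoc (f n k) (d ℕ.* c) c ⟩
  f n k ℕ.+ (d ℕ.* c ℕ.+ c)                               ≡⟨ cong (f n k ℕ.+_) (ℕP.+-comm (d ℕ.* c) c) ⟩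
  f n k ℕ.+ suc d ℕ.* c                                   ∎
  where
  open ≡-Reasoning
  c = f (+ (2 ^ k) - n) k

n≤2^⌈log₂n⌉ : ∀ n → n ℕ.≤ 2 ^ ⌈log₂ n ⌉
n≤2^⌈log₂n⌉ n = go n (<-wellFounded n)
  where
  -- Recursing on the accessibility proof lets ⌈log2⌉ unfold definitionally.
  go : ∀ n (rec : Acc ℕ._<_ n) → n ℕ.≤ 2 ^ ⌈log2⌉ n rec
  go 0 _ = z≤n
  go 1 _ = s≤s z≤n
  go (suc (suc n)) (acc rs) = begin
    suc (suc n)                        ≡⟨ cong (suc ∘ suc) (ℕP.⌊n/2⌋+⌈n/2⌉≡n n) ⟨
    suc (suc (⌊ n /2⌋ ℕ.+ ⌈ n /2⌉))    ≤⟨ s≤s (s≤s (ℕP.+-monoˡ-≤ ⌈ n /2⌉ (ℕP.⌊n/2⌋≤⌈n/2⌉ n))) ⟩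
    suc (suc (⌈ n /2⌉ ℕ.+ ⌈ n /2⌉))    ≡⟨ cong suc (ℕP.+-suc ⌈ n /2⌉ ⌈ n /2⌉) ⟨
    suc ⌈ n /2⌉ ℕ.+ suc ⌈ n /2⌉        ≡⟨ cong (suc ⌈ n /2⌉ ℕ.+_) (ℕP.+-identityʳ (suc ⌈ n /2⌉)) ⟨
    2 ℕ.* suc ⌈ n /2⌉                  ≤⟨ ℕP.*-monoʳ-≤ 2 (go (suc ⌈ n /2⌉) (rs _)) ⟩
    2 ℕ.* 2 ^ ⌈log2⌉ (suc ⌈ n /2⌉) _   ∎
    where open ℕP.≤-Reasoning

theorem7 : (i : ℕ) (n : ℤ) → + 0 < n → n < + (2 ^ i) →
    (k : ℕ) → k ≡ ⌈log₂ Data.Integer.∣ n ∣ ⌉ →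
    f n i ≡ Data.Nat._+_ (f n k) (Data.Nat._*_ (i ∸ k) (f (+ (2 ^ k) - n) k))
theorem7 i (+ x) _ (+<+ x<2^i) _ refl =
  trans (cong (f (+ x)) (sym (ℕP.m∸n+n≡m k≤i)))
        (f-extra-bits (+≤+ z≤n) (+≤+ (n≤2^⌈log₂n⌉ x)) (i ∸ ⌈log₂ x ⌉))
  where
  k≤i : ⌈log₂ x ⌉ ℕ.≤ i
  k≤i = subst (⌈log₂ x ⌉ ℕ.≤_) (⌈log₂2^n⌉≡n i) (⌈log₂⌉-mono-≤ (ℕP.<⇒≤ x<2^i))
theorem7 i -[1+ _ ] () _ _ _
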